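{- Let $q$ be a prime and let $j$ be a positive integer. Then $q^j$ is product-admissible if and only if $j\geq 2q+4$.
   Context: For a multiset $\{x_1,\dots,x_n\}$ of positive integers define $T\{x_1,\dots,x_n\}=(x_1+\cdots+x_n,\,x_1x_2\cdots x_n,\,n)$. An ordered triple $(s,p,n)$ of positive integers is called admissible if there exist at least two different multisets $X$, $Y$ of $n$ positive integers with $T(X)=T(Y)=(s,p,n)$. A positive integer $p$ is product-admissible if there exist positive integers $s$ and $n$ such that $(s,p,n)$ is admissible. -}

module Defs where

open import Data.Nat using (ℕ; _≤_; _<_)
open import Data.List using (List; length)
open import Data.Nat.ListAction using (sum; product)
open import Data.List.Relation.Unary.All using (All)
open import Data.List.Relation.Binary.Permutation.Propositional using (_↭_)
open import Data.Product using (Σ; ∃; _×_; _,_)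
open import Relation.Nullary using (¬_)
open import Relation.Binary.PropositionalEquality using (_≡_)

-- A finite multiset of positive integers is represented by a list of
-- positive naturals; two lists represent the same multiset iff they are
-- permutations of each other (_↭_).

HasT : ℕ → ℕ → ℕ → List ℕ → Set
HasT s p n X = All (λ x → 1 ≤ x) X × length X ≡ n × sum X ≡ s × product X ≡ p

Admissible : ℕ → ℕ → ℕ → Set
Admissible s p n =
  Σ (List ℕ) λ X → Σ (List ℕ) λ Y →
    HasT s p n X × HasT s p n Y × ¬ (X ↭ Y)

ProductAdmissible : ℕ → Set
ProductAdmissible p = ∃ λ s → ∃ λ n → 1 ≤ s × 1 ≤ n × Admissible s p n

-- Since q is prime, a multiset with product q^j consists of powers q^a, a ∈ A, for a multiset A
-- of exponents with Σ A = j. Let cᵢ = above i A be the number of exponents exceeding i, so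
-- c₀ ≥ c₁ ≥ ⋯ and Σ cᵢ = j. Then Σ_{a ∈ A} q^a = |A| + (q − 1) Σ cᵢ qⁱ, so two such multisets
-- of equal size and sum have equal Σ cᵢ qⁱ, and they coincide as soon as their counts cᵢ do.
-- If j ≤ 2q + 3 then cᵢ < q for i ≥ 3, so the tail (c₃, c₄, …) consists of base-q digits, and a
-- digit string has the least digit sum among all representations of its value. Hence the two
-- tails have the same value: otherwise levels 0 to 2 of one side would have to absorb a carry of
-- q³, which c₀ + c₁ + c₂ ≤ 2q + 3 forbids. Equal tails are equal digit strings, and on the three
-- remaining levels the same bound rules out a carry, so all cᵢ agree.
-- If j ≥ 2q + 4, then with t = j − 2q − 4 the multisets q^t·{q³, q^(2q + 1 times)} and
-- q^t·{q²^(q + 2 times), 1^(q times)} are distinct with the same size, sum and product.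
module Submission where

open import Defs
open import Data.Empty using (⊥; ⊥-elim)
open import Data.List using (List; []; _∷_; _++_; length; map; replicate)
open import Data.List.Properties using (length-map; length-++; length-replicate; map-++; map-replicate)
open import Data.List.Membership.Propositional using (_∈_)
open import Data.List.Membership.Propositional.Properties using (∈-map⁺; ∈-++⁺ʳ)
open import Data.List.Relation.Binary.Permutation.Propositional
  using (_↭_; prep; ↭-refl; ↭-trans; ↭-sym; module PermutationReasoning)
open import Data.List.Relation.Binary.Permutation.Propositional.Properties
  using (↭-length; ++⁺ˡ; shift; drop-∷; ∈-resp-↭) renaming (map⁺ to ↭-map⁺)
open import Data.List.Relation.Unary.All as All using (All; _∷_)
open import Data.List.Relation.Unary.All.Properties using (replicate⁺) renaming (map⁺ to All-map⁺)
open import Data.List.Relation.Unary.Any using (here)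
open import Data.Nat
  using (ℕ; zero; suc; _+_; _*_; _^_; _∸_; _≤_; _<_; z≤n; s≤s; NonZero; nonTrivial⇒n>1; _≤?_)
open import Data.Nat.DivMod using (_%_; [m+kn]%n≡m%n; m<n⇒m%n≡m)
open import Data.Nat.Divisibility using (divides)
open import Data.Nat.ListAction using (sum; product)
open import Data.Nat.ListAction.Properties using (sum-++)
open import Data.Nat.Primality using (Prime; euclidsLemma; prime⇒nonZero; prime⇒nonTrivial)
open import Data.Nat.Properties
open import Algebra.Properties.CommutativeSemigroup +-commutativeSemigroup
  using () renaming ( x∙yz≈y∙xz to m+[n+o]≡n+[m+o]; x∙yz≈xz∙y to m+[n+o]≡m+o+n
                    ; x∙yz≈yx∙z to m+[n+o]≡n+m+o; xy∙z≈xz∙y to m+n+o≡m+o+n)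
open import Algebra.Properties.CommutativeSemigroup *-commutativeSemigroup
  using () renaming (xy∙z≈xz∙y to m*n*o≡m*o*n)
open import Data.Nat.Tactic.RingSolver using (solve-∀)
open import Data.Product using (∃-syntax; _×_; _,_)
open import Data.Sum using (inj₁; inj₂)
open import Function.Bundles using (_⇔_; mk⇔)
open import Relation.Binary.Definitions using (tri<; tri≈; tri>)
open import Relation.Binary.PropositionalEquality
  using (_≡_; refl; sym; trans; cong; cong₂; subst; module ≡-Reasoning)
open import Relation.Nullary using (¬_; yes; no)

sum-replicate : ∀ k x → sum (replicate k x) ≡ k * x
sum-replicate zero    x = refl
sum-replicate (suc k) x = cong (x +_) (sum-replicate k x)

product-map-^ : ∀ m A → product (map (m ^_) A) ≡ m ^ sum A
product-map-^ m []      = refl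
product-map-^ m (a ∷ A) =
  trans (cong (m ^ a *_) (product-map-^ m A)) (sym (^-distribˡ-+-* m a (sum A)))

[1+m*n]+[o+m*p]≡1+o+m*[n+p] : ∀ m n o p → (1 + m * n) + (o + m * p) ≡ suc o + m * (n + p)
[1+m*n]+[o+m*p]≡1+o+m*[n+p] = solve-∀

low-digit-unique : ∀ {b} .{{_ : NonZero b}} {m m′ n n′} → m < b → m′ < b →
                   m + b * n ≡ m′ + b * n′ → m ≡ m′ × n ≡ n′
low-digit-unique {b} {m} {m′} {n} {n′} m<b m′<b eq =
  m≡m′ , *-cancelˡ-≡ n n′ b (+-cancelˡ-≡ m _ _ (trans eq (cong (_+ b * n′) (sym m≡m′))))
  where
  low-digit : ∀ {k} l → k < b → (k + b * l) % b ≡ k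
  low-digit {k} l k<b = begin
    (k + b * l) % b ≡⟨ cong (λ x → (k + x) % b) (*-comm b l) ⟩
    (k + l * b) % b ≡⟨ [m+kn]%n≡m%n k l b ⟩
    k % b           ≡⟨ m<n⇒m%n≡m k<b ⟩
    k               ∎
    where open ≡-Reasoning
  m≡m′ : m ≡ m′
  m≡m′ = trans (sym (low-digit n m<b)) (trans (cong (_% b) eq) (low-digit n′ m′<b))

high-digits-≤ : ∀ {b m n n′} → m < b → b * n ≤ m + b * n′ → n ≤ n′
high-digits-≤ {b} {m} {n} {n′} m<b le = ≤-pred (*-cancelˡ-< b n (suc n′) (begin-strict
  b * n      ≤⟨ le ⟩
  m + b * n′ <⟨ +-monoˡ-< (b * n′) m<b ⟩
  b + b * n′ ≡⟨ *-suc b n′ ⟨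
  b * suc n′ ∎))
  where open ≤-Reasoning

module _ {p : ℕ} (p-prime : Prime p) where

  private instance
    p≢0 : NonZero p
    p≢0 = prime⇒nonZero p-prime

  prime-power-factors : ∀ k x y → x * y ≡ p ^ k →
                        ∃[ i ] ∃[ j ] x ≡ p ^ i × y ≡ p ^ j × i + j ≡ k
  prime-power-factors zero x y xy≡1 =
    0 , 0 , m*n≡1⇒m≡1 x y xy≡1 , m*n≡1⇒n≡1 x y xy≡1 , refl
  prime-power-factors (suc k) x y xy≡
    with euclidsLemma x y p-prime (divides (p ^ k) (trans xy≡ (*-comm p (p ^ k))))
  ... | inj₁ (divides x′ refl)
    with i , j , refl , refl , i+j≡k ← prime-power-factors k x′ y
           (*-cancelʳ-≡ _ _ p (trans (m*n*o≡m*o*n x′ y p) (trans xy≡ (*-comm p (p ^ k)))))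
    = suc i , j , *-comm (p ^ i) p , refl , cong suc i+j≡k
  ... | inj₂ (divides y′ refl)
    with i , j , refl , refl , i+j≡k ← prime-power-factors k x y′
           (*-cancelʳ-≡ _ _ p (trans (*-assoc x y′ p) (trans xy≡ (*-comm p (p ^ k)))))
    = i , suc j , refl , *-comm (p ^ j) p , trans (+-suc i j) (cong suc i+j≡k)

  prime-power-product : ∀ k X → product X ≡ p ^ k → ∃[ A ] X ≡ map (p ^_) A × sum A ≡ k
  prime-power-product k [] 1≡p^k with m^n≡1⇒n≡0∨m≡1 p k (sym 1≡p^k)
  ... | inj₁ refl = [] , refl , refl
  ... | inj₂ p≡1  = ⊥-elim (<⇒≢ (nonTrivial⇒n>1 p {{prime⇒nonTrivial p-prime}}) (sym p≡1))
  prime-power-product k (x ∷ X) xX≡p^k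
    with i , j , refl , X≡p^j , i+j≡k ← prime-power-factors k x (product X) xX≡p^k
    with A , refl , refl ← prime-power-product j X X≡p^j
    = i ∷ A , refl , i+j≡k

lower : List ℕ → List ℕ
lower []          = []
lower (zero  ∷ X) = lower X
lower (suc x ∷ X) = x ∷ lower X

lower^ : ℕ → List ℕ → List ℕ
lower^ zero    X = X
lower^ (suc i) X = lower^ i (lower X)

nonzeros : List ℕ → ℕ
nonzeros X = length (lower X)

above : ℕ → List ℕ → ℕ
above i X = nonzeros (lower^ i X)

zeros : List ℕ → ℕ
zeros []          = 0
zeros (zero  ∷ X) = suc (zeros X)
zeros (suc _ ∷ X) = zeros X

length≡zeros+nonzeros : ∀ X → length X ≡ zeros X + nonzeros X
length≡zeros+nonzeros []          = refl
length≡zeros+nonzeros (zero  ∷ X) = cong suc (length≡zeros+nonzeros X)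
length≡zeros+nonzeros (suc _ ∷ X) =
  trans (cong suc (length≡zeros+nonzeros X)) (sym (+-suc (zeros X) (nonzeros X)))

↭-zeros++map-suc-lower : ∀ X → X ↭ replicate (zeros X) 0 ++ map suc (lower X)
↭-zeros++map-suc-lower []          = ↭-refl
↭-zeros++map-suc-lower (zero  ∷ X) = prep 0 (↭-zeros++map-suc-lower X)
↭-zeros++map-suc-lower (suc x ∷ X) = ↭-trans (prep (suc x) (↭-zeros++map-suc-lower X))
  (↭-sym (shift (suc x) (replicate (zeros X) 0) (map suc (lower X))))

↭-from-lower : ∀ {X Y} → length X ≡ length Y → lower X ↭ lower Y → X ↭ Y
↭-from-lower {X} {Y} |X|≡|Y| lowers↭ = begin
  X                                          ↭⟨ ↭-zeros++map-suc-lower X ⟩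
  replicate (zeros X) 0 ++ map suc (lower X) ≡⟨ cong (λ z → replicate z 0 ++ map suc (lower X)) zeros≡ ⟩
  replicate (zeros Y) 0 ++ map suc (lower X) ↭⟨ ++⁺ˡ (replicate (zeros Y) 0) (↭-map⁺ suc lowers↭) ⟩
  replicate (zeros Y) 0 ++ map suc (lower Y) ↭⟨ ↭-zeros++map-suc-lower Y ⟨
  Y                                          ∎
  where
  open PermutationReasoning
  zeros≡ : zeros X ≡ zeros Y
  zeros≡ = +-cancelʳ-≡ (nonzeros X) (zeros X) (zeros Y)
    (trans (sym (length≡zeros+nonzeros X)) (trans |X|≡|Y| (trans (length≡zeros+nonzeros Y)
      (cong (zeros Y +_) (sym (↭-length lowers↭))))))

sum≡nonzeros+sum-lower : ∀ X → sum X ≡ nonzeros X + sum (lower X)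
sum≡nonzeros+sum-lower []          = refl
sum≡nonzeros+sum-lower (zero  ∷ X) = sum≡nonzeros+sum-lower X
sum≡nonzeros+sum-lower (suc x ∷ X) = cong suc (begin
  x + sum X                        ≡⟨ cong (x +_) (sum≡nonzeros+sum-lower X) ⟩
  x + (nonzeros X + sum (lower X)) ≡⟨ m+[n+o]≡n+[m+o] x (nonzeros X) (sum (lower X)) ⟩
  nonzeros X + (x + sum (lower X)) ∎)
  where open ≡-Reasoning

nonzeros-lower≤ : ∀ X → nonzeros (lower X) ≤ nonzeros X
nonzeros-lower≤ []                = z≤n
nonzeros-lower≤ (zero        ∷ X) = nonzeros-lower≤ X
nonzeros-lower≤ (suc zero    ∷ X) = m≤n⇒m≤1+n (nonzeros-lower≤ X)
nonzeros-lower≤ (suc (suc _) ∷ X) = s≤s (nonzeros-lower≤ X)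

above-antitone : ∀ i X → above (suc i) X ≤ above i X
above-antitone zero    X = nonzeros-lower≤ X
above-antitone (suc i) X = above-antitone i (lower X)

nonzeros≤sum : ∀ X → nonzeros X ≤ sum X
nonzeros≤sum X = subst (nonzeros X ≤_) (sym (sum≡nonzeros+sum-lower X)) (m≤m+n _ _)

size : List ℕ → ℕ
size X = length X + sum X

size-lower< : ∀ x X → size (lower (x ∷ X)) < size (x ∷ X)
size-lower< x X = subst (_< size (x ∷ X)) (sum≡nonzeros+sum-lower (x ∷ X))
  (s≤s (m≤n+m (sum (x ∷ X)) (length X)))

weight : ℕ → List ℕ → ℕ
weight k X = sum X + k * nonzeros X

weight-suc : ∀ k X → weight k X ≤ weight (suc k) X
weight-suc k X = +-monoʳ-≤ (sum X) (m≤n+m (k * nonzeros X) (nonzeros X))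

weight-lower : ∀ k X → weight (suc k) (lower X) ≤ weight k X
weight-lower k X = begin
  sum (lower X) + suc k * nonzeros (lower X)
    ≤⟨ +-monoʳ-≤ (sum (lower X)) (*-monoʳ-≤ (suc k) (nonzeros-lower≤ X)) ⟩
  sum (lower X) + (nonzeros X + k * nonzeros X) ≡⟨ m+[n+o]≡n+m+o (sum (lower X)) (nonzeros X) _ ⟩
  nonzeros X + sum (lower X) + k * nonzeros X   ≡⟨ cong (_+ k * nonzeros X) (sum≡nonzeros+sum-lower X) ⟨
  sum X + k * nonzeros X                        ∎
  where open ≤-Reasoning

suc-k*nonzeros≤weight : ∀ k X → suc k * nonzeros X ≤ weight k X
suc-k*nonzeros≤weight k X = +-monoˡ-≤ (k * nonzeros X) (nonzeros≤sum X)

weight-lower³≤sum : ∀ X → weight 3 (lower^ 3 X) ≤ sum X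
weight-lower³≤sum X = begin
  weight 3 (lower^ 3 X) ≤⟨ weight-lower 2 (lower^ 2 X) ⟩
  weight 2 (lower^ 2 X) ≤⟨ weight-lower 1 (lower X) ⟩
  weight 1 (lower X)    ≤⟨ weight-lower 0 X ⟩
  weight 0 X            ≡⟨ +-identityʳ (sum X) ⟩
  sum X                 ∎
  where open ≤-Reasoning

-- The base is q = r + 2, so that q − 1 = suc r needs no truncated subtraction.
module Radix (r : ℕ) where

  q : ℕ
  q = suc (suc r)

  repunit : ℕ → ℕ
  repunit zero    = 0
  repunit (suc a) = 1 + q * repunit a

  -- Equal to Σᵢ qⁱ · above i X by repunitSum-lower.
  repunitSum : List ℕ → ℕ
  repunitSum X = sum (map repunit X)

  ^≡1+repunit : ∀ a → q ^ a ≡ 1 + suc r * repunit a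
  ^≡1+repunit zero    = cong suc (sym (*-zeroʳ (suc r)))
  ^≡1+repunit (suc a) = trans (cong (q *_) (^≡1+repunit a)) (identity r (repunit a))
    where
    identity : ∀ m n → suc (suc m) * (1 + suc m * n) ≡ 1 + suc m * (1 + suc (suc m) * n)
    identity = solve-∀

  sum-map-^ : ∀ A → sum (map (q ^_) A) ≡ length A + suc r * repunitSum A
  sum-map-^ []      = sym (*-zeroʳ (suc r))
  sum-map-^ (a ∷ A) = trans (cong₂ _+_ (^≡1+repunit a) (sum-map-^ A))
    ([1+m*n]+[o+m*p]≡1+o+m*[n+p] (suc r) (repunit a) (length A) (repunitSum A))

  repunitSum-lower : ∀ X → repunitSum X ≡ nonzeros X + q * repunitSum (lower X)
  repunitSum-lower []          = sym (*-zeroʳ q)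
  repunitSum-lower (zero  ∷ X) = repunitSum-lower X
  repunitSum-lower (suc x ∷ X) = trans (cong (repunit (suc x) +_) (repunitSum-lower X))
    ([1+m*n]+[o+m*p]≡1+o+m*[n+p] q (repunit x) (nonzeros X) (repunitSum (lower X)))

  repunitSum-replicate : ∀ k a → repunitSum (replicate k a) ≡ k * repunit a
  repunitSum-replicate k a =
    trans (cong sum (map-replicate repunit k a)) (sum-replicate k (repunit a))

  repunitSum-++ : ∀ X Y → repunitSum (X ++ Y) ≡ repunitSum X + repunitSum Y
  repunitSum-++ X Y =
    trans (cong sum (map-++ repunit X Y)) (sum-++ (map repunit X) (map repunit Y))

  0<repunitSum⇒0<length : ∀ X → 0 < repunitSum X → 0 < length X
  0<repunitSum⇒0<length (_ ∷ _) _ = s≤s z≤n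

  sum-map-^-injective : ∀ A B → length A ≡ length B → sum (map (q ^_) A) ≡ sum (map (q ^_) B) →
                        repunitSum A ≡ repunitSum B
  sum-map-^-injective A B |A|≡|B| sums≡ = *-cancelˡ-≡ _ _ (suc r) (+-cancelˡ-≡ (length A) _ _
    (trans (sym (sum-map-^ A)) (trans sums≡
      (trans (sum-map-^ B) (cong (_+ suc r * repunitSum B) (sym |A|≡|B|))))))

  record Small (k : ℕ) (X : List ℕ) : Set where
    constructor small
    field weight< : weight k X < suc k * q

  small-lower : ∀ {k X} → Small k X → Small k (lower X)
  small-lower {k} {X} (small weight<) =
    small (≤-<-trans (≤-trans (weight-suc k (lower X)) (weight-lower k X)) weight<)

  small⇒nonzeros<q : ∀ {k X} → Small k X → nonzeros X < q
  small⇒nonzeros<q {k} {X} (small weight<) =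
    *-cancelˡ-< (suc k) _ _ (≤-<-trans (suc-k*nonzeros≤weight k X) weight<)

  small-lower³ : ∀ X → sum X ≤ 2 * q + 3 → Small 3 (lower^ 3 X)
  small-lower³ X sum≤ = small (≤-<-trans (weight-lower³≤sum X) (≤-<-trans sum≤ 2q+3<4q))
    where
    identity : ∀ m → suc (2 * suc (suc m) + 3) + 2 * m ≡ 4 * suc (suc m)
    identity = solve-∀
    2q+3<4q : 2 * q + 3 < 4 * q
    2q+3<4q = subst (suc (2 * q + 3) ≤_) (identity r) (m≤m+n _ (2 * r))

  small-repunitSum-injective : ∀ {k X Y} → Small k X → Small k Y → length X ≡ length Y →
                               repunitSum X ≡ repunitSum Y → X ↭ Y
  small-repunitSum-injective {X = X} = go (size X) ≤-refl
    where
    go : ∀ n {k X Y} → size X ≤ n → Small k X → Small k Y → length X ≡ length Y →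
         repunitSum X ≡ repunitSum Y → X ↭ Y
    go _       {X = []}    {[]}    _ _ _ _  _ = ↭-refl
    go _       {X = []}    {_ ∷ _} _ _ _ () _
    go zero    {X = _ ∷ _} ()
    go (suc n) {X = X@(x ∷ X′)} {Y} size≤ small-X small-Y |X|≡|Y| R≡
      with nonzeros≡ , R-lower≡ ← low-digit-unique (small⇒nonzeros<q small-X) (small⇒nonzeros<q small-Y)
             (trans (sym (repunitSum-lower X)) (trans R≡ (repunitSum-lower Y)))
      = ↭-from-lower |X|≡|Y| (go n (≤-pred (≤-trans (size-lower< x X′) size≤))
          (small-lower small-X) (small-lower small-Y) nonzeros≡ R-lower≡)

  small-repunitSum-difference : ∀ {k X Y} d → Small k Y → repunitSum Y ≡ repunitSum X + d →
    ∃[ e ] repunitSum (lower Y) ≡ repunitSum (lower X) + e × nonzeros Y + q * e ≡ nonzeros X + d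
  small-repunitSum-difference {X = X} {Y} d small-Y R≡ = e , R-lower≡ , digits≡
    where
    a = repunitSum (lower Y)
    b = repunitSum (lower X)
    b≤a : b ≤ a
    b≤a = high-digits-≤ (small⇒nonzeros<q small-Y) (begin
      q * b                  ≤⟨ m≤n+m (q * b) (nonzeros X) ⟩
      nonzeros X + q * b     ≤⟨ m≤m+n _ d ⟩
      nonzeros X + q * b + d ≡⟨ cong (_+ d) (repunitSum-lower X) ⟨
      repunitSum X + d       ≡⟨ R≡ ⟨
      repunitSum Y           ≡⟨ repunitSum-lower Y ⟩
      nonzeros Y + q * a     ∎)
      where open ≤-Reasoning
    e = a ∸ b
    R-lower≡ : a ≡ b + e
    R-lower≡ = sym (m+[n∸m]≡n b≤a)
    digits≡ : nonzeros Y + q * e ≡ nonzeros X + d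
    digits≡ = +-cancelʳ-≡ (q * b) _ _ (begin
      nonzeros Y + q * e + q * b ≡⟨ identity (nonzeros Y) q e b ⟩
      nonzeros Y + q * (b + e)   ≡⟨ cong (λ z → nonzeros Y + q * z) R-lower≡ ⟨
      nonzeros Y + q * a         ≡⟨ repunitSum-lower Y ⟨
      repunitSum Y               ≡⟨ R≡ ⟩
      repunitSum X + d           ≡⟨ cong (_+ d) (repunitSum-lower X) ⟩
      nonzeros X + q * b + d     ≡⟨ m+n+o≡m+o+n (nonzeros X) (q * b) d ⟩
      nonzeros X + d + q * b     ∎)
      where
      open ≡-Reasoning
      identity : ∀ m n o p → m + n * o + n * p ≡ m + n * (p + o)
      identity = solve-∀

  small-sum-minimal : ∀ {k X Y} d → Small k Y → repunitSum Y ≡ repunitSum X + d → sum Y ≤ sum X + d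
  small-sum-minimal {X = X} {Y} d = go (size Y) {X = X} {Y} d ≤-refl
    where
    go : ∀ n {k X Y} d → size Y ≤ n → Small k Y → repunitSum Y ≡ repunitSum X + d →
         sum Y ≤ sum X + d
    go _       {Y = []}    _ _ _ _ = z≤n
    go zero    {Y = _ ∷ _} _ ()
    go (suc n) {X = X} {Y@(y ∷ Y′)} d size≤ small-Y R≡
      with e , R-lower≡ , digits≡ ← small-repunitSum-difference {X = X} d small-Y R≡ = begin
      sum Y                                ≡⟨ sum≡nonzeros+sum-lower Y ⟩
      nonzeros Y + sum (lower Y)           ≤⟨ +-monoʳ-≤ (nonzeros Y) (go n {X = lower X} {lower Y} e
                                                 (≤-pred (≤-trans (size-lower< y Y′) size≤))
                                                 (small-lower small-Y) R-lower≡) ⟩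
      nonzeros Y + (sum (lower X) + e)     ≤⟨ +-monoʳ-≤ (nonzeros Y) (+-monoʳ-≤ (sum (lower X)) (m≤n*m e q)) ⟩
      nonzeros Y + (sum (lower X) + q * e) ≡⟨ m+[n+o]≡m+o+n (nonzeros Y) (sum (lower X)) (q * e) ⟩
      nonzeros Y + q * e + sum (lower X)   ≡⟨ cong (_+ sum (lower X)) digits≡ ⟩
      nonzeros X + d + sum (lower X)       ≡⟨ m+n+o≡m+o+n (nonzeros X) d (sum (lower X)) ⟩
      nonzeros X + sum (lower X) + d       ≡⟨ cong (_+ d) (sum≡nonzeros+sum-lower X) ⟨
      sum X + d                            ∎
      where open ≤-Reasoning

  value₃ : ℕ → ℕ → ℕ → ℕ
  value₃ c₀ c₁ c₂ = c₀ + q * (c₁ + q * c₂)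

  excess : ℕ → ℕ → ℕ
  excess c₁ c₂ = c₁ + suc q * c₂

  value₃≡sum+excess : ∀ c₀ c₁ c₂ → value₃ c₀ c₁ c₂ ≡ c₀ + c₁ + c₂ + suc r * excess c₁ c₂
  value₃≡sum+excess = identity r
    where
    identity : ∀ m c₀ c₁ c₂ → c₀ + suc (suc m) * (c₁ + suc (suc m) * c₂) ≡
                              c₀ + c₁ + c₂ + suc m * (c₁ + suc (suc (suc m)) * c₂)
    identity = solve-∀

  excess-bound : ∀ {c₀ c₁ c₂} → c₁ ≤ c₀ → c₂ ≤ c₁ → 6 * excess c₁ c₂ ≤ (2 * q + 4) * (c₀ + c₁ + c₂)
  excess-bound {c₀} {c₁} {c₂} c₁≤c₀ c₂≤c₁ = begin
    6 * excess c₁ c₂                                  ≡⟨ split q c₁ c₂ ⟩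
    3 * (c₁ + c₁ + c₂) + (2 * q + 1) * (c₂ + c₂ + c₂)
      ≤⟨ +-mono-≤ (*-monoʳ-≤ 3 2c₁+c₂≤) (*-monoʳ-≤ (2 * q + 1) 3c₂≤) ⟩
    3 * (c₀ + c₁ + c₂) + (2 * q + 1) * (c₀ + c₁ + c₂) ≡⟨ merge q (c₀ + c₁ + c₂) ⟩
    (2 * q + 4) * (c₀ + c₁ + c₂)                      ∎
    where
    open ≤-Reasoning
    split : ∀ n c₁ c₂ → 6 * (c₁ + suc n * c₂) ≡ 3 * (c₁ + c₁ + c₂) + (2 * n + 1) * (c₂ + c₂ + c₂)
    split = solve-∀
    merge : ∀ n t → 3 * t + (2 * n + 1) * t ≡ (2 * n + 4) * t
    merge = solve-∀
    2c₁+c₂≤ : c₁ + c₁ + c₂ ≤ c₀ + c₁ + c₂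
    2c₁+c₂≤ = +-monoˡ-≤ c₂ (+-monoˡ-≤ c₁ c₁≤c₀)
    3c₂≤ : c₂ + c₂ + c₂ ≤ c₀ + c₁ + c₂
    3c₂≤ = +-monoˡ-≤ c₂ (+-mono-≤ (≤-trans c₂≤c₁ c₁≤c₀) c₂≤c₁)

  -- A carry at level 2 forces c₁ ≥ q + 2, hence c₀ + c₁ ≥ 2q + 4.
  carry⇒large : ∀ {c₀ c₁ c₂ d₁ d₂} → c₁ ≤ c₀ → c₂ < d₂ → d₂ ≤ d₁ →
                excess c₁ c₂ ≡ excess d₁ d₂ → 2 * q + 3 < c₀ + c₁ + c₂
  carry⇒large {c₀} {c₁} {c₂} {d₁} {d₂} c₁≤c₀ c₂<d₂ d₂≤d₁ excess≡ = begin
    suc (2 * q + 3)   ≡⟨ identity q ⟩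
    (2 + q) + (2 + q) ≤⟨ +-mono-≤ (≤-trans 2+q≤c₁ c₁≤c₀) 2+q≤c₁ ⟩
    c₀ + c₁           ≤⟨ m≤m+n (c₀ + c₁) c₂ ⟩
    c₀ + c₁ + c₂      ∎
    where
    open ≤-Reasoning
    identity : ∀ n → suc (2 * n + 3) ≡ (2 + n) + (2 + n)
    identity = solve-∀
    2+q≤c₁ : 2 + q ≤ c₁
    2+q≤c₁ = +-cancelʳ-≤ (suc q * c₂) (2 + q) c₁ (begin
      2 + q + suc q * c₂ ≡⟨ cong suc (*-suc (suc q) c₂) ⟨
      1 + suc q * suc c₂ ≤⟨ +-mono-≤ (≤-trans (≤-trans (s≤s z≤n) c₂<d₂) d₂≤d₁) (*-monoʳ-≤ (suc q) c₂<d₂) ⟩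
      d₁ + suc q * d₂    ≡⟨ excess≡ ⟨
      c₁ + suc q * c₂    ∎)

  three-levels-rigid : ∀ {c₀ c₁ c₂ d₀ d₁ d₂} → c₁ ≤ c₀ → c₂ ≤ c₁ → d₁ ≤ d₀ → d₂ ≤ d₁ →
                       c₀ + c₁ + c₂ ≤ 2 * q + 3 → c₀ + c₁ + c₂ ≡ d₀ + d₁ + d₂ →
                       value₃ c₀ c₁ c₂ ≡ value₃ d₀ d₁ d₂ → c₀ ≡ d₀ × c₁ ≡ d₁ × c₂ ≡ d₂
  three-levels-rigid {c₀} {c₁} {c₂} {d₀} {d₁} {d₂} c₁≤c₀ c₂≤c₁ d₁≤d₀ d₂≤d₁ sum≤ sum≡ value≡ =
    c₀≡d₀ , c₁≡d₁ , c₂≡d₂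
    where
    excess≡ : excess c₁ c₂ ≡ excess d₁ d₂
    excess≡ = *-cancelˡ-≡ _ _ (suc r) (+-cancelˡ-≡ (c₀ + c₁ + c₂) _ _
      (trans (sym (value₃≡sum+excess c₀ c₁ c₂)) (trans value≡
        (trans (value₃≡sum+excess d₀ d₁ d₂) (cong (_+ suc r * excess d₁ d₂) (sym sum≡))))))
    c₂≡d₂ : c₂ ≡ d₂
    c₂≡d₂ with <-cmp c₂ d₂
    ... | tri< c₂<d₂ _ _ = ⊥-elim (<⇒≱ (carry⇒large c₁≤c₀ c₂<d₂ d₂≤d₁ excess≡) sum≤)
    ... | tri≈ _ c₂≡d₂ _ = c₂≡d₂
    ... | tri> _ _ d₂<c₂ = ⊥-elim (<⇒≱ (carry⇒large d₁≤d₀ d₂<c₂ c₂≤c₁ (sym excess≡))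
                                        (subst (_≤ 2 * q + 3) sum≡ sum≤))
    c₁≡d₁ : c₁ ≡ d₁
    c₁≡d₁ = +-cancelʳ-≡ (suc q * c₂) c₁ d₁ (trans excess≡ (cong (λ z → d₁ + suc q * z) (sym c₂≡d₂)))
    c₀≡d₀ : c₀ ≡ d₀
    c₀≡d₀ = +-cancelʳ-≡ c₁ c₀ d₀ (+-cancelʳ-≡ c₂ (c₀ + c₁) (d₀ + c₁)
      (trans sum≡ (cong₂ (λ x y → d₀ + x + y) (sym c₁≡d₁) (sym c₂≡d₂))))

  -- The carry forces excess c₁ c₂ ≥ q² + 2q + 3, whereas excess-bound and the bound on
  -- c₀ + c₁ + c₂ give 6 · excess c₁ c₂ ≤ (2q + 4)(2q + 3).
  tail-carry-impossible : ∀ {c₀ c₁ c₂ d₀ d₁ d₂ D} → c₁ ≤ c₀ → c₂ ≤ c₁ → d₂ ≤ d₁ → 0 < d₂ → 0 < D →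
                          c₀ + c₁ + c₂ ≤ 2 * q + 3 → c₀ + c₁ + c₂ ≤ d₀ + d₁ + d₂ + D →
                          value₃ c₀ c₁ c₂ ≡ value₃ d₀ d₁ d₂ + q * (q * (q * D)) → ⊥
  tail-carry-impossible {c₀} {c₁} {c₂} {d₀} {d₁} {d₂} {D} c₁≤c₀ c₂≤c₁ d₂≤d₁ 0<d₂ 0<D sum≤ sums≤ value≡ =
    <⇒≱ gap (begin
      6 * (1 + suc q * 1 + K * 1)  ≤⟨ *-monoʳ-≤ 6 lower-bound ⟩
      6 * (excess d₁ d₂ + K * D)   ≤⟨ *-monoʳ-≤ 6 excess≤ ⟩
      6 * excess c₁ c₂             ≤⟨ excess-bound c₁≤c₀ c₂≤c₁ ⟩
      (2 * q + 4) * (c₀ + c₁ + c₂) ≤⟨ *-monoʳ-≤ (2 * q + 4) sum≤ ⟩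
      (2 * q + 4) * (2 * q + 3)    ∎)
    where
    open ≤-Reasoning
    K = 1 + q + q * q
    cube : ∀ m d₀ d₁ d₂ D → let n = suc (suc m) in
           d₀ + n * (d₁ + n * d₂) + n * (n * (n * D)) ≡
           d₀ + d₁ + d₂ + D + suc m * (d₁ + suc n * d₂ + (1 + n + n * n) * D)
    cube = solve-∀
    excess≤ : excess d₁ d₂ + K * D ≤ excess c₁ c₂
    excess≤ = *-cancelˡ-≤ (suc r) (+-cancelˡ-≤ (d₀ + d₁ + d₂ + D) _ _ (begin
      d₀ + d₁ + d₂ + D + suc r * (excess d₁ d₂ + K * D) ≡⟨ cube r d₀ d₁ d₂ D ⟨
      value₃ d₀ d₁ d₂ + q * (q * (q * D))               ≡⟨ value≡ ⟨
      value₃ c₀ c₁ c₂                                   ≡⟨ value₃≡sum+excess c₀ c₁ c₂ ⟩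
      c₀ + c₁ + c₂ + suc r * excess c₁ c₂               ≤⟨ +-monoˡ-≤ _ sums≤ ⟩
      d₀ + d₁ + d₂ + D + suc r * excess c₁ c₂           ∎))
    lower-bound : 1 + suc q * 1 + K * 1 ≤ excess d₁ d₂ + K * D
    lower-bound = +-mono-≤ (+-mono-≤ (≤-trans 0<d₂ d₂≤d₁) (*-monoʳ-≤ (suc q) 0<d₂)) (*-monoʳ-≤ K 0<D)
    numbers : ∀ m → let n = suc (suc m) in
              suc ((2 * n + 4) * (2 * n + 3)) + (2 * m * m + 6 * m + 9) ≡
              6 * (1 + suc n * 1 + (1 + n + n * n) * 1)
    numbers = solve-∀
    gap : (2 * q + 4) * (2 * q + 3) < 6 * (1 + suc q * 1 + K * 1)
    gap = subst (suc ((2 * q + 4) * (2 * q + 3)) ≤_) (numbers r) (m≤m+n _ _)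

  levelSum₃ : List ℕ → ℕ
  levelSum₃ X = above 0 X + above 1 X + above 2 X

  levelValue₃ : List ℕ → ℕ
  levelValue₃ X = value₃ (above 0 X) (above 1 X) (above 2 X)

  sum-by-levels : ∀ X → sum X ≡ levelSum₃ X + sum (lower^ 3 X)
  sum-by-levels X = begin
    sum X                          ≡⟨ sum≡nonzeros+sum-lower X ⟩
    c₀ + sum (lower X)             ≡⟨ cong (c₀ +_) (sum≡nonzeros+sum-lower (lower X)) ⟩
    c₀ + (c₁ + sum (lower^ 2 X))   ≡⟨ cong (λ z → c₀ + (c₁ + z)) (sum≡nonzeros+sum-lower (lower^ 2 X)) ⟩
    c₀ + (c₁ + (c₂ + sum (lower^ 3 X))) ≡⟨ reassociate c₀ c₁ c₂ (sum (lower^ 3 X)) ⟩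
    c₀ + c₁ + c₂ + sum (lower^ 3 X) ∎
    where
    open ≡-Reasoning
    c₀ = above 0 X
    c₁ = above 1 X
    c₂ = above 2 X
    reassociate : ∀ a b c d → a + (b + (c + d)) ≡ a + b + c + d
    reassociate = solve-∀

  repunitSum-by-levels : ∀ X → repunitSum X ≡ levelValue₃ X + q * (q * (q * repunitSum (lower^ 3 X)))
  repunitSum-by-levels X = begin
    repunitSum X                                 ≡⟨ repunitSum-lower X ⟩
    c₀ + q * repunitSum (lower X)                ≡⟨ cong (λ z → c₀ + q * z) (repunitSum-lower (lower X)) ⟩
    c₀ + q * (c₁ + q * repunitSum (lower^ 2 X))  ≡⟨ cong (λ z → c₀ + q * (c₁ + q * z))
                                                         (repunitSum-lower (lower^ 2 X)) ⟩
    c₀ + q * (c₁ + q * (c₂ + q * t))             ≡⟨ reassociate q c₀ c₁ c₂ t ⟩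
    value₃ c₀ c₁ c₂ + q * (q * (q * t))          ∎
    where
    open ≡-Reasoning
    c₀ = above 0 X
    c₁ = above 1 X
    c₂ = above 2 X
    t = repunitSum (lower^ 3 X)
    reassociate : ∀ n a b c d → a + n * (b + n * (c + n * d)) ≡ a + n * (b + n * c) + n * (n * (n * d))
    reassociate = solve-∀

  tail-repunitSum-≤ : ∀ A B → sum A ≤ 2 * q + 3 → sum A ≡ sum B → repunitSum A ≡ repunitSum B →
                      repunitSum (lower^ 3 B) ≤ repunitSum (lower^ 3 A)
  tail-repunitSum-≤ A B sum≤ sum≡ R≡ = ≮⇒≥ carry
    where
    carry : ¬ repunitSum (lower^ 3 A) < repunitSum (lower^ 3 B)
    carry tailA<tailB = tail-carry-impossible
      (above-antitone 0 A) (above-antitone 1 A) (above-antitone 1 B)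
      (0<repunitSum⇒0<length (lower^ 3 B) (≤-<-trans z≤n tailA<tailB)) (m<n⇒0<n∸m tailA<tailB)
      (≤-trans (m≤m+n (levelSum₃ A) _) (subst (_≤ 2 * q + 3) (sum-by-levels A) sum≤))
      levels≤ value≡
      where
      a = repunitSum (lower^ 3 A)
      D = repunitSum (lower^ 3 B) ∸ a
      tailR≡ : repunitSum (lower^ 3 B) ≡ a + D
      tailR≡ = sym (m+[n∸m]≡n (<⇒≤ tailA<tailB))
      tail-sum≤ : sum (lower^ 3 B) ≤ sum (lower^ 3 A) + D
      tail-sum≤ = small-sum-minimal {X = lower^ 3 A} D
        (small-lower³ B (subst (_≤ 2 * q + 3) sum≡ sum≤)) tailR≡
      levels≤ : levelSum₃ A ≤ levelSum₃ B + D
      levels≤ = +-cancelʳ-≤ (sum (lower^ 3 A)) (levelSum₃ A) (levelSum₃ B + D) (begin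
        levelSum₃ A + sum (lower^ 3 A)       ≡⟨ sum-by-levels A ⟨
        sum A                                ≡⟨ sum≡ ⟩
        sum B                                ≡⟨ sum-by-levels B ⟩
        levelSum₃ B + sum (lower^ 3 B)       ≤⟨ +-monoʳ-≤ (levelSum₃ B) tail-sum≤ ⟩
        levelSum₃ B + (sum (lower^ 3 A) + D) ≡⟨ m+[n+o]≡m+o+n (levelSum₃ B) (sum (lower^ 3 A)) D ⟩
        levelSum₃ B + D + sum (lower^ 3 A)   ∎)
        where open ≤-Reasoning
      value≡ : levelValue₃ A ≡ levelValue₃ B + q * (q * (q * D))
      value≡ = +-cancelʳ-≡ (q * (q * (q * a))) (levelValue₃ A) (levelValue₃ B + q * (q * (q * D))) (begin
        levelValue₃ A + q * (q * (q * a))                       ≡⟨ repunitSum-by-levels A ⟨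
        repunitSum A                                            ≡⟨ R≡ ⟩
        repunitSum B                                            ≡⟨ repunitSum-by-levels B ⟩
        levelValue₃ B + q * (q * (q * repunitSum (lower^ 3 B)))
          ≡⟨ cong (λ z → levelValue₃ B + q * (q * (q * z))) tailR≡ ⟩
        levelValue₃ B + q * (q * (q * (a + D)))                 ≡⟨ split q (levelValue₃ B) a D ⟩
        levelValue₃ B + q * (q * (q * D)) + q * (q * (q * a))   ∎)
        where
        open ≡-Reasoning
        split : ∀ n v a d → v + n * (n * (n * (a + d))) ≡ v + n * (n * (n * d)) + n * (n * (n * a))
        split = solve-∀

  small-exponents-rigid : ∀ A B → length A ≡ length B → sum A ≡ sum B → sum A ≤ 2 * q + 3 →
                          repunitSum A ≡ repunitSum B → A ↭ B
  small-exponents-rigid A B |A|≡|B| sum≡ sumA≤ R≡ =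
    let above₀≡ , above₁≡ , above₂≡ = three-levels-rigid
          (above-antitone 0 A) (above-antitone 1 A) (above-antitone 0 B) (above-antitone 1 B)
          (≤-trans (m≤m+n (levelSum₃ A) _) (subst (_≤ 2 * q + 3) (sum-by-levels A) sumA≤))
          levels≡ value≡
    in ↭-from-lower |A|≡|B| (↭-from-lower above₀≡ (↭-from-lower above₁≡
         (small-repunitSum-injective small-A small-B above₂≡ tailR≡)))
    where
    sumB≤ : sum B ≤ 2 * q + 3
    sumB≤ = subst (_≤ 2 * q + 3) sum≡ sumA≤
    small-A = small-lower³ A sumA≤
    small-B = small-lower³ B sumB≤
    tailR≡ : repunitSum (lower^ 3 A) ≡ repunitSum (lower^ 3 B)
    tailR≡ = ≤-antisym (tail-repunitSum-≤ B A sumB≤ (sym sum≡) (sym R≡)) (tail-repunitSum-≤ A B sumA≤ sum≡ R≡)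
    sum-≤ : ∀ {k} X Y → Small k X → repunitSum X ≡ repunitSum Y → sum X ≤ sum Y
    sum-≤ X Y small-X R≡′ = subst (sum X ≤_) (+-identityʳ (sum Y))
      (small-sum-minimal {X = Y} 0 small-X (trans R≡′ (sym (+-identityʳ (repunitSum Y)))))
    tail-sum≡ : sum (lower^ 3 A) ≡ sum (lower^ 3 B)
    tail-sum≡ = ≤-antisym (sum-≤ (lower^ 3 A) (lower^ 3 B) small-A tailR≡)
                          (sum-≤ (lower^ 3 B) (lower^ 3 A) small-B (sym tailR≡))
    levels≡ : levelSum₃ A ≡ levelSum₃ B
    levels≡ = +-cancelʳ-≡ (sum (lower^ 3 A)) (levelSum₃ A) (levelSum₃ B)
      (trans (sym (sum-by-levels A)) (trans sum≡
        (trans (sum-by-levels B) (cong (levelSum₃ B +_) (sym tail-sum≡)))))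
    value≡ : levelValue₃ A ≡ levelValue₃ B
    value≡ = +-cancelʳ-≡ (q * (q * (q * repunitSum (lower^ 3 A)))) (levelValue₃ A) (levelValue₃ B)
      (trans (sym (repunitSum-by-levels A)) (trans R≡ (trans (repunitSum-by-levels B)
        (cong (λ z → levelValue₃ B + q * (q * (q * z))) (sym tailR≡)))))

  exponents-HasT : ∀ A {s j n} → length A ≡ n → sum A ≡ j → length A + suc r * repunitSum A ≡ s →
                   HasT s (q ^ j) n (map (q ^_) A)
  exponents-HasT A |A|≡n sum≡j value≡s =
    All-map⁺ (All.universal (m^n>0 q) A) , trans (length-map (q ^_) A) |A|≡n ,
    trans (sum-map-^ A) value≡s , trans (product-map-^ q A) (cong (q ^_) sum≡j)

  small-exponent⇒¬admissible : Prime q → ∀ {s j n} → j ≤ 2 * q + 3 → ¬ Admissible s (q ^ j) n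
  small-exponent⇒¬admissible q-prime j≤
    (X , Y , (_ , |X|≡n , sumX≡s , productX≡) , (_ , |Y|≡n , sumY≡s , productY≡) , X≁Y)
    with A , refl , sumA≡j ← prime-power-product q-prime _ X productX≡
       | B , refl , sumB≡j ← prime-power-product q-prime _ Y productY≡
    = X≁Y (↭-map⁺ (q ^_) (small-exponents-rigid A B |A|≡|B| (trans sumA≡j (sym sumB≡j))
        (subst (_≤ 2 * q + 3) (sym sumA≡j) j≤) (sum-map-^-injective A B |A|≡|B| (trans sumX≡s (sym sumY≡s)))))
    where
    |A|≡|B| = trans (sym (length-map (q ^_) A)) (trans (trans |X|≡n (sym |Y|≡n)) (length-map (q ^_) B))

  productAdmissible⇒large-exponent : Prime q → ∀ {j} → ProductAdmissible (q ^ j) → 2 * q + 4 ≤ j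
  productAdmissible⇒large-exponent q-prime {j} (_ , _ , _ , _ , admissible) with 2 * q + 4 ≤? j
  ... | yes large = large
  ... | no ¬large = ⊥-elim (small-exponent⇒¬admissible q-prime
    (≤-pred (subst (suc j ≤_) (+-suc (2 * q) 3) (≰⇒> ¬large))) admissible)

  distinct-exponents⇒admissible :
    ∀ A B → length A ≡ length B → sum A ≡ sum B → repunitSum A ≡ repunitSum B →
    ¬ (map (q ^_) A ↭ map (q ^_) B) → Admissible (length A + suc r * repunitSum A) (q ^ sum A) (length A)
  distinct-exponents⇒admissible A B |A|≡|B| sum≡ R≡ distinct =
    map (q ^_) A , map (q ^_) B ,
    exponents-HasT A refl refl refl ,
    exponents-HasT B (sym |A|≡|B|) (sym sum≡) (cong₂ (λ l v → l + suc r * v) (sym |A|≡|B|) (sym R≡)) ,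
    distinct

  exponents₁ exponents₂ : ℕ → List ℕ
  exponents₁ t = t ∷ 3 ∷ replicate (2 * q + 1) 1
  exponents₂ t = t ∷ replicate (2 + q) 2 ++ replicate q 0

  length-exponents : ∀ t → length (exponents₁ t) ≡ length (exponents₂ t)
  length-exponents t = trans (cong (2 +_) (length-replicate (2 * q + 1)))
    (trans (identity q) (cong suc (sym (trans (length-++ (replicate (2 + q) 2))
                                           (cong₂ _+_ (length-replicate (2 + q)) (length-replicate q))))))
    where
    identity : ∀ n → 2 + (2 * n + 1) ≡ 1 + ((2 + n) + n)
    identity = solve-∀

  sum-exponents₁ : ∀ t → sum (exponents₁ t) ≡ t + (2 * q + 4)
  sum-exponents₁ t = trans (cong (λ z → t + (3 + z)) (sum-replicate (2 * q + 1) 1)) (identity q t)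
    where
    identity : ∀ n t → t + (3 + (2 * n + 1) * 1) ≡ t + (2 * n + 4)
    identity = solve-∀

  sum-exponents₂ : ∀ t → sum (exponents₂ t) ≡ t + (2 * q + 4)
  sum-exponents₂ t = trans (cong (t +_) (trans (sum-++ (replicate (2 + q) 2) (replicate q 0))
                                          (cong₂ _+_ (sum-replicate (2 + q) 2) (sum-replicate q 0))))
                           (identity q t)
    where
    identity : ∀ n t → t + ((2 + n) * 2 + n * 0) ≡ t + (2 * n + 4)
    identity = solve-∀

  repunitSum-exponents : ∀ t → repunitSum (exponents₁ t) ≡ repunitSum (exponents₂ t)
  repunitSum-exponents t = cong (repunit t +_) (begin
    repunit 3 + repunitSum (replicate (2 * q + 1) 1)
      ≡⟨ cong (repunit 3 +_) (repunitSum-replicate (2 * q + 1) 1) ⟩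
    repunit 3 + (2 * q + 1) * repunit 1
      ≡⟨ identity r ⟩
    (2 + q) * repunit 2 + q * repunit 0
      ≡⟨ cong₂ _+_ (repunitSum-replicate (2 + q) 2) (repunitSum-replicate q 0) ⟨
    repunitSum (replicate (2 + q) 2) + repunitSum (replicate q 0)
      ≡⟨ repunitSum-++ (replicate (2 + q) 2) (replicate q 0) ⟨
    repunitSum (replicate (2 + q) 2 ++ replicate q 0)
      ∎)
    where
    open ≡-Reasoning
    identity : ∀ m → let n = suc (suc m) in
               (1 + n * (1 + n * (1 + n * 0))) + (2 * n + 1) * (1 + n * 0) ≡
               (2 + n) * (1 + n * (1 + n * 0)) + n * 0
    identity = solve-∀

  -- Only the second multiset contains q⁰ = 1 besides the common factor q^t.
  exponents-distinct : ∀ t → ¬ (map (q ^_) (exponents₁ t) ↭ map (q ^_) (exponents₂ t))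
  exponents-distinct t powers↭ =
    1+n≰n (All.lookup (All-map⁺ {P = 2 ≤_} all≥2) (∈-resp-↭ (↭-sym (drop-∷ powers↭)) 1∈))
    where
    all≥2 : All (λ a → 2 ≤ q ^ a) (3 ∷ replicate (2 * q + 1) 1)
    all≥2 = s≤s (s≤s z≤n) ∷ replicate⁺ (2 * q + 1) (s≤s (s≤s z≤n))
    1∈ : 1 ∈ map (q ^_) (replicate (2 + q) 2 ++ replicate q 0)
    1∈ = ∈-map⁺ (q ^_) (∈-++⁺ʳ (replicate (2 + q) 2) (here refl))

  large-exponent⇒productAdmissible : ∀ {j} → 2 * q + 4 ≤ j → ProductAdmissible (q ^ j)
  large-exponent⇒productAdmissible {j} 2q+4≤j =
    subst (λ k → ProductAdmissible (q ^ k)) (trans (sum-exponents₁ t) (m∸n+n≡m 2q+4≤j))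
      (_ , _ , s≤s z≤n , s≤s z≤n , distinct-exponents⇒admissible (exponents₁ t) (exponents₂ t)
        (length-exponents t) (trans (sum-exponents₁ t) (sym (sum-exponents₂ t)))
        (repunitSum-exponents t) (exponents-distinct t))
    where
    t = j ∸ (2 * q + 4)

prime⇒2+ : ∀ {q} → Prime q → ∃[ r ] q ≡ suc (suc r)
prime⇒2+ {suc (suc r)} _       = r , refl
prime⇒2+ {0}           q-prime with () ← nonTrivial⇒n>1 0 {{prime⇒nonTrivial q-prime}}
prime⇒2+ {1}           q-prime with s≤s () ← nonTrivial⇒n>1 1 {{prime⇒nonTrivial q-prime}}

theorem3p2 : (q j : ℕ) → Prime q → 1 ≤ j →
    ProductAdmissible (q ^ j) ⇔ (2 * q + 4 ≤ j)
theorem3p2 q j q-prime _ with r , refl ← prime⇒2+ q-prime =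
  mk⇔ (productAdmissible⇒large-exponent q-prime) large-exponent⇒productAdmissible
  where open Radix r
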